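{- Let $\varphi$ be a basic existential or basic universal sentence of spread $m$ and range $r'$ over a graph language $L$. Let $C,M\notin L$ be distinct unary predicate symbols. Let $G$ be an $L$-interpretation and let $\lambda$ be a layering of $\overline{G}$. Let $r\ge r'$ and $\ell>4r$ be integers, let $R$ be an $(\ell,r)$-cover of integers, and let $p$ be an $m$-plan for $R$. Suppose that for each $I\in R$ we have $$G[\lambda^{ -1}(I)],\ C:=\lambda^{ -1}(M_{2r}(I)),\ M:=\lambda^{ -1}(M_r(I))\models\varphi^{(p(I))},$$ where $\varphi^{(p(I))}$ is the $(C,M,p(I))$-variant of $\varphi$. Then $G\models\varphi$.
   Context: A graph language $L$ consists of a binary symbol $e$ (adjacency) and finitely many unary predicate symbols; an $L$-interpretation $G$ is a graph $\overline{G}$ together with a subset of $V(\overline{G})$ for each unary symbol. For $S\subseteq V(\overline{G})$, $G[S]$ is the interpretation on $\overline{G}[S]$ with each unary predicate restricted to $S$; the notation $H,C:=A,M:=B$ means $H$ extended by interpreting $C$ as $A$ and $M$ as $B$. A layering of a graph $H$ is $\lambda:V(H)\to\mathbb{Z}$ with $|\lambda(u)-\lambda(v)|\le1$ for every edge $uv$. $d(x,y)\le r$ abbreviates the first-order formula $(\exists z_0,\ldots,z_r)\,z_0=x\land z_r=y\land\bigwedge_{i=1}^r(z_{i-1}=z_i\lor e(z_{i-1},z_i))$, and $d(x,y)>r$ its negation. An $r$-local formula is a formula $\psi$ with one free variable $x$ all of whose quantifiers are of the form $(\exists y:d(x,y)\le r)$ or $(\forall y:d(x,y)\le r)$. A basic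 existential sentence is $(\exists x_1,\ldots,x_m)\bigwedge_{1\le i<j\le m}d(x_i,x_j)>2r\land\bigwedge_{i=1}^m\psi(x_i)$, and a basic universal sentence is $(\forall x_1,\ldots,x_{m+1})\bigwedge_{1\le i<j\le m+1}d(x_i,x_j)>2r\Rightarrow\bigvee_{i=1}^{m+1}\psi(x_i)$, where in both cases $\psi$ is $r$-local; $m$ is the spread, $r$ the range and $\psi$ the core. For such $\varphi$ (spread $m$, range $r$, core $\psi$) and an integer $0\le k\le m$, the $(C,M,k)$-variant $\varphi^{(k)}$ is $(\exists x_1,\ldots,x_k)\bigwedge_{1\le i<j\le k}d(x_i,x_j)>2r\land\bigwedge_{i=1}^k(C(x_i)\land\psi(x_i))$ if $\varphi$ is basic existential, and $(\forall x_1,\ldots,x_{k+1})\bigl(\bigwedge_{i=1}^{k+1}M(x_i)\land\bigwedge_{1\le i<j\le k+1}d(x_i,x_j)>2r\bigr)\Rightarrow\bigvee_{i=1}^{k+1}\psi(x_i)$ if $\varphi$ is basic universal. For integers $\ell\ge2r+1$ and $n$, the $(\ell,r)$-cover of integers determined by $n$ is the set of all intervals $\{i,i+1,\ldots,i+\ell-1\}$ with $i\equiv n\pmod{\ell-2r}$ (there are exactly $\ell-2r$ distinct $(\ell,r)$-covers). For such an interval $I=\{i,\ldots,i+\ell-1\}$ and an integer $d\ge0$, $M_d(I)=\{i+d,\ldots,i+\ell-d-1\}$. For an integer $m\ge0$, an $m$-plan for a cover $R$ is a function $p:R\to\mathbb{Z}_{\ge0}$ with $\sum_{I\in R}p(I)=m$.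 -}

module Defs where

open import Data.Nat using (ℕ; zero; suc; _+_; _*_; _∸_; _<ᵇ_)
open import Data.Fin using (Fin; zero; suc; toℕ; fromℕ)
import Data.Fin as Fin
open import Data.Bool using (Bool; true; false; _∧_; _∨_; not; T; if_then_else_)
open import Data.Integer using (ℤ; +_; 1ℤ; ∣_∣) renaming (_+_ to _+ℤ_; _-_ to _-ℤ_; _*_ to _*ℤ_; _≤?_ to _≤ℤ?_)
open import Data.List using (List; allFin; map)
open import Data.Bool.ListAction using (any; all)
open import Data.Nat.ListAction using (sum)
open import Data.List.Membership.Propositional using (_∉_)
open import Data.List.Relation.Unary.Unique.Propositional using (Unique)
open import Relation.Nullary.Decidable using (⌊_⌋)
open import Relation.Binary.PropositionalEquality using (_≡_)

-- Variables are de Bruijn indices: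
-- in  Fm U n  the free variables are Fin n, and a quantifier binds
-- variable zero (older variables are shifted by suc).

data Fm (U : Set) : ℕ → Set where
  E    : ∀ {n} → Fin n → Fin n → Fm U n
  Eq   : ∀ {n} → Fin n → Fin n → Fm U n
  P    : ∀ {n} → U → Fin n → Fm U n
  ⊤'   : ∀ {n} → Fm U n
  ⊥'   : ∀ {n} → Fm U n
  ¬'_  : ∀ {n} → Fm U n → Fm U n
  _∧'_ : ∀ {n} → Fm U n → Fm U n → Fm U n
  _∨'_ : ∀ {n} → Fm U n → Fm U n → Fm U n
  _⇒'_ : ∀ {n} → Fm U n → Fm U n → Fm U n
  ∃'   : ∀ {n} → Fm U (suc n) → Fm U n
  ∀'   : ∀ {n} → Fm U (suc n) → Fm U n

infixr 6 _∧'_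
infixr 5 _∨'_
infixr 4 _⇒'_

liftRen : ∀ {n m} → (Fin n → Fin m) → Fin (suc n) → Fin (suc m)
liftRen ρ zero    = zero
liftRen ρ (suc i) = suc (ρ i)

rename : ∀ {U n m} → (Fin n → Fin m) → Fm U n → Fm U m
rename ρ (E i j)   = E (ρ i) (ρ j)
rename ρ (Eq i j)  = Eq (ρ i) (ρ j)
rename ρ (P u i)   = P u (ρ i)
rename ρ ⊤'        = ⊤'
rename ρ ⊥'        = ⊥'
rename ρ (¬' φ)    = ¬' rename ρ φ
rename ρ (φ ∧' ψ)  = rename ρ φ ∧' rename ρ ψ
rename ρ (φ ∨' ψ)  = rename ρ φ ∨' rename ρ ψ
rename ρ (φ ⇒' ψ)  = rename ρ φ ⇒' rename ρ ψ
rename ρ (∃' φ)    = ∃' (rename (liftRen ρ) φ)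
rename ρ (∀' φ)    = ∀' (rename (liftRen ρ) φ)

mapSym : ∀ {U U' n} → (U → U') → Fm U n → Fm U' n
mapSym f (E i j)  = E i j
mapSym f (Eq i j) = Eq i j
mapSym f (P u i)  = P (f u) i
mapSym f ⊤'       = ⊤'
mapSym f ⊥'       = ⊥'
mapSym f (¬' φ)   = ¬' mapSym f φ
mapSym f (φ ∧' ψ) = mapSym f φ ∧' mapSym f ψ
mapSym f (φ ∨' ψ) = mapSym f φ ∨' mapSym f ψ
mapSym f (φ ⇒' ψ) = mapSym f φ ⇒' mapSym f ψ
mapSym f (∃' φ)   = ∃' (mapSym f φ)
mapSym f (∀' φ)   = ∀' (mapSym f φ)

-- d(x,y) ≤ r : there is a sequence z_0 = x, …, z_r = y with consecutive
-- entries equal or adjacent (written with nested existentials).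
dist≤ : ∀ {U n} → ℕ → Fin n → Fin n → Fm U n
dist≤ zero    i j = Eq i j
dist≤ (suc r) i j = ∃' (dist≤ r (suc i) zero ∧' (Eq zero (suc j) ∨' E zero (suc j)))

-- In  Fm U (suc n)  the distinguished free variable x
-- is the outermost one, i.e. index  fromℕ n.
data Local {U : Set} (r : ℕ) : ∀ {n} → Fm U (suc n) → Set where
  E    : ∀ {n} (i j : Fin (suc n)) → Local r {n} (E i j)
  Eq   : ∀ {n} (i j : Fin (suc n)) → Local r {n} (Eq i j)
  P    : ∀ {n} (u : U) (i : Fin (suc n)) → Local r {n} (P u i)
  ⊤'   : ∀ {n} → Local r {n} ⊤'
  ⊥'   : ∀ {n} → Local r {n} ⊥'
  ¬'_  : ∀ {n} {φ} → Local r {n} φ → Local r (¬' φ)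
  _∧'_ : ∀ {n} {φ ψ} → Local r {n} φ → Local r {n} ψ → Local r (φ ∧' ψ)
  _∨'_ : ∀ {n} {φ ψ} → Local r {n} φ → Local r {n} ψ → Local r (φ ∨' ψ)
  _⇒'_ : ∀ {n} {φ ψ} → Local r {n} φ → Local r {n} ψ → Local r (φ ⇒' ψ)
  ∃loc : ∀ {n} {θ : Fm U (suc (suc n))} → Local r {suc n} θ →
         Local r {n} (∃' (dist≤ r (fromℕ (suc n)) zero ∧' θ))
  ∀loc : ∀ {n} {θ : Fm U (suc (suc n))} → Local r {suc n} θ →
         Local r {n} (∀' (dist≤ r (fromℕ (suc n)) zero ⇒' θ))

bigAnd : ∀ {U n} (k : ℕ) → (Fin k → Fm U n) → Fm U n
bigAnd zero    f = ⊤'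
bigAnd (suc k) f = f zero ∧' bigAnd k (λ i → f (suc i))

bigOr : ∀ {U n} (k : ℕ) → (Fin k → Fm U n) → Fm U n
bigOr zero    f = ⊥'
bigOr (suc k) f = f zero ∨' bigOr k (λ i → f (suc i))

exs : ∀ {U} (k : ℕ) → Fm U k → Fm U 0
exs zero    φ = φ
exs (suc k) φ = exs k (∃' φ)

alls : ∀ {U} (k : ℕ) → Fm U k → Fm U 0
alls zero    φ = φ
alls (suc k) φ = alls k (∀' φ)

inst : ∀ {U k} → Fm U 1 → Fin k → Fm U k
inst ψ i = rename (λ _ → i) ψ

pairwiseFar : ∀ {U} (r k : ℕ) → Fm U k
pairwiseFar r k = bigAnd k (λ i → bigAnd k (λ j →
  if toℕ i <ᵇ toℕ j then ¬' dist≤ (2 * r) i j else ⊤'))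

data Kind : Set where
  existential universal : Kind

basic : ∀ {U} → Kind → (m r : ℕ) → Fm U 1 → Fm U 0
basic existential m r ψ = exs m (pairwiseFar r m ∧' bigAnd m (inst ψ))
basic universal   m r ψ = alls (suc m) (pairwiseFar r (suc m) ⇒' bigOr (suc m) (inst ψ))

data Ext (U : Set) : Set where
  old : U → Ext U
  C M : Ext U

variant : ∀ {U} → Kind → (k r : ℕ) → Fm U 1 → Fm (Ext U) 0
variant existential k r ψ =
  exs k (pairwiseFar r k ∧' bigAnd k (λ i → P C i ∧' inst (mapSym old ψ) i))
variant universal k r ψ =
  alls (suc k) ((bigAnd (suc k) (P M) ∧' pairwiseFar r (suc k))
                 ⇒' bigOr (suc k) (inst (mapSym old ψ)))

-- L-interpretations (finite).  The underlying graph has vertex set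
-- { v : Fin N | dom v ≡ true }, with a symmetric irreflexive adjacency.

record Str (U : Set) : Set where
  field
    N       : ℕ
    dom     : Fin N → Bool
    adj     : Fin N → Fin N → Bool
    adj-sym : ∀ u v → adj u v ≡ adj v u
    adj-irr : ∀ v → adj v v ≡ false
    pred    : U → Fin N → Bool
open Str public

induced : ∀ {U} (G : Str U) → (Fin (N G) → Bool) → Str U
induced G S = record G { dom = λ v → dom G v ∧ S v ; pred = λ u v → pred G u v ∧ S v }

extend : ∀ {U} (G : Str U) → (A B : Fin (N G) → Bool) → Str (Ext U)
extend G A B = record
  { N = N G ; dom = dom G ; adj = adj G ; adj-sym = adj-sym G ; adj-irr = adj-irr G
  ; pred = λ { (old u) → pred G u ; C → A ; M → B } }

extEnv : ∀ {A : Set} {n} → A → (Fin n → A) → Fin (suc n) → A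
extEnv a ρ zero    = a
extEnv a ρ (suc i) = ρ i

sat : ∀ {U n} (G : Str U) → Fm U n → (Fin n → Fin (N G)) → Bool
sat G (E i j)  ρ = adj G (ρ i) (ρ j)
sat G (Eq i j) ρ = ⌊ ρ i Fin.≟ ρ j ⌋
sat G (P u i)  ρ = pred G u (ρ i)
sat G ⊤'       ρ = true
sat G ⊥'       ρ = false
sat G (¬' φ)   ρ = not (sat G φ ρ)
sat G (φ ∧' ψ) ρ = sat G φ ρ ∧ sat G ψ ρ
sat G (φ ∨' ψ) ρ = sat G φ ρ ∨ sat G ψ ρ
sat G (φ ⇒' ψ) ρ = not (sat G φ ρ) ∨ sat G ψ ρ
sat G (∃' φ)   ρ = any (λ v → dom G v ∧ sat G φ (extEnv v ρ)) (allFin (N G))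
sat G (∀' φ)   ρ = all (λ v → not (dom G v) ∨ sat G φ (extEnv v ρ)) (allFin (N G))

_⊨_ : ∀ {U} → Str U → Fm U 0 → Set
G ⊨ φ = T (sat G φ (λ ()))

IsLayering : ∀ {U} (G : Str U) → (Fin (N G) → ℤ) → Set
IsLayering G lay = ∀ u v → T (dom G u) → T (dom G v) → T (adj G u v) →
  ∣ lay u -ℤ lay v ∣ Data.Nat.≤ 1

inIv : ℤ → ℤ → ℤ → Bool
inIv lo hi z = ⌊ lo ≤ℤ? z ⌋ ∧ ⌊ z ≤ℤ? hi ⌋

preimage : ∀ {N : ℕ} → (Fin N → ℤ) → (ℤ → Bool) → Fin N → Bool
preimage lay S v = S (lay v)

-- The (ℓ,r)-cover determined by n consists of the intervals
-- I_t = {s_t, …, s_t + ℓ - 1} with s_t = n + t(ℓ - 2r), t ∈ ℤ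
-- (t ↦ I_t is a bijection ℤ → cover since ℓ - 2r ≥ 1).
coverStart : (ℓ r : ℕ) (n t : ℤ) → ℤ
coverStart ℓ r n t = n +ℤ t *ℤ (+ (ℓ ∸ 2 * r))

coverIv : (ℓ r : ℕ) (n t : ℤ) → ℤ → Bool
coverIv ℓ r n t = inIv s (s +ℤ + ℓ -ℤ 1ℤ)
  where s = coverStart ℓ r n t

coverMid : (ℓ r : ℕ) (n t : ℤ) (d : ℕ) → ℤ → Bool
coverMid ℓ r n t d = inIv (s +ℤ + d) (s +ℤ + ℓ -ℤ + d -ℤ 1ℤ)
  where s = coverStart ℓ r n t

-- An m-plan for a cover (indexed by t ∈ ℤ as above): p : cover → ℕ
-- whose (necessarily finitely supported) sum is m.
record Plan (m : ℕ) : Set where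
  field
    p       : ℤ → ℕ
    supp    : List ℤ
    uniq    : Unique supp
    outside : ∀ t → t ∉ supp → p t ≡ 0
    total   : sum (map p supp) ≡ m
open Plan public

module Submission where

-- A walk of length d changes the layer by at most d, so the d-ball around a vertex
-- whose layer lies in M_e(I) stays inside λ⁻¹(I) when d ≤ e.  Hence r'-local
-- formulas, and being at distance at most 2r', read the same in G and in the
-- window G[λ⁻¹(I)] at such vertices.  Distinct sets M_2r(I) of one cover are
-- separated by more than 2r layers, because consecutive intervals overlap in
-- exactly 2r layers.
--
-- Existential case: the windows provide p(I) pairwise far ψ-vertices in
-- λ⁻¹(M_2r(I)) for each I; vertices coming from different intervals are far apart
-- by the separation, so together they are m pairwise far ψ-vertices of G.
-- Universal case: the sets M_r(I) tile ℤ, so given m + 1 pairwise far vertices,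
-- and a plan handing out only m, some I receives more than p(I) of them; the
-- universal variant in that window makes one of them satisfy ψ.

open import Defs
open import Data.Nat using (ℕ; zero; suc; _+_; _*_; _∸_; _≤_; _<_; _<ᵇ_; _<?_; z≤n; s≤s; NonZero; >-nonZero)
import Data.Nat.Properties as ℕ
open import Data.Nat.ListAction using (sum)
open import Data.Integer using (ℤ; +_; -[1+_]; 0ℤ; 1ℤ; -1ℤ; ∣_∣; +≤+; -≤+; _≤?_)
  renaming (_+_ to _+ℤ_; _-_ to _-ℤ_; _*_ to _*ℤ_; _≤_ to _≤ℤ_; _<_ to _<ℤ_)
import Data.Integer.Properties as ℤ
open import Data.Integer.DivMod using (_/ℕ_; _%ℕ_; a≡a%ℕn+[a/ℕn]*n; n%ℕd<d)
open import Data.Integer.Tactic.RingSolver using (solve-∀)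
open import Data.Fin as Fin using (Fin; zero; suc; toℕ; fromℕ)
import Data.Fin.Properties as Fin
open import Data.Bool using (Bool; true; false; _∧_; _∨_; not; T; if_then_else_)
open import Data.Bool.Properties using (T-∧; T-∨; ∧-zeroʳ; ∨-zeroʳ)
open import Data.Bool.ListAction using (any; all; or; and)
open import Data.Unit using (tt)
open import Data.Empty using (⊥-elim)
open import Data.Product using (Σ; ∃; _×_; _,_; proj₁; proj₂)
open import Data.Sum using (_⊎_; inj₁; inj₂)
open import Data.List using (List; []; _∷_; _++_; length; filter; map; lookup; tabulate; allFin)
open import Data.List.Properties using (map-cong; length-++; length-tabulate; filter-some)
open import Data.List.Membership.Propositional using (_∈_; _∉_; lose)
open import Data.List.Membership.Propositional.Properties using (∈-allFin; ∈-lookup; ∈-filter⁻)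
open import Data.List.Relation.Unary.Any as Any using (here; there; satisfied)
open import Data.List.Relation.Unary.Any.Properties using (any⁺; any⁻)
open import Data.List.Relation.Unary.All as All using (All; []; _∷_)
open import Data.List.Relation.Unary.All.Properties as All using (all⁺; all⁻; all-filter)
open import Data.List.Relation.Unary.AllPairs as AllPairs using (AllPairs; []; _∷_)
import Data.List.Relation.Unary.AllPairs.Properties as AllPairs
open import Data.List.Relation.Unary.Unique.Propositional using (Unique)
import Data.List.Relation.Unary.Unique.Propositional.Properties as Unique
open import Data.List.Relation.Binary.Sublist.Propositional.Properties
  using (filter⁺; filter-⊆; length-mono-≤)
open import Function.Base using (_∘_)
open import Function.Bundles using (Equivalence)
open import Relation.Nullary using (¬_; yes; no; ¬?)
open import Relation.Nullary.Decidable using (⌊_⌋; toWitness; fromWitness)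
open import Relation.Binary.Definitions using (DecidableEquality; tri<; tri≈; tri>)
open import Relation.Binary.PropositionalEquality

open Equivalence using (to; from)

T-not⁺ : ∀ {a} → ¬ T a → T (not a)
T-not⁺ {false} _  = tt
T-not⁺ {true}  ¬a = ¬a tt

T-not⁻ : ∀ {a} → T (not a) → ¬ T a
T-not⁻ {false} _ ()

T-⇒⁺ : ∀ {a b} → (T a → T b) → T (not a ∨ b)
T-⇒⁺ {false} _   = tt
T-⇒⁺ {true}  a⇒b = a⇒b tt

T-⇒⁻ : ∀ {a b} → T (not a ∨ b) → T a → T b
T-⇒⁻ {true} b _ = b

T-injective : ∀ {a b} → (T a → T b) → (T b → T a) → a ≡ b
T-injective {false} {false} _   _   = refl
T-injective {false} {true}  _   b⇒a = ⊥-elim (b⇒a tt)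
T-injective {true}  {false} a⇒b _   = ⊥-elim (a⇒b tt)
T-injective {true}  {true}  _   _   = refl

-- Relativising a guarded quantifier to s changes nothing when the guard g forces s.
relativize-∃ : ∀ d s g {t t'} → (T d → T g → T s) → (T d → T g → t' ≡ t) →
  (d ∧ s) ∧ (g ∧ t') ≡ d ∧ (g ∧ t)
relativize-∃ false s     g     _   _    = refl
relativize-∃ true  s     false _   _    = ∧-zeroʳ s
relativize-∃ true  false true  g⇒s _    = ⊥-elim (g⇒s tt tt)
relativize-∃ true  true  true  _   t'≡t = t'≡t tt tt

relativize-∀ : ∀ d s g {t t'} → (T d → T g → T s) → (T d → T g → t' ≡ t) →
  not (d ∧ s) ∨ (not g ∨ t') ≡ not d ∨ (not g ∨ t)
relativize-∀ false s     g     _   _    = refl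
relativize-∀ true  s     false _   _    = ∨-zeroʳ (not s)
relativize-∀ true  false true  g⇒s _    = ⊥-elim (g⇒s tt tt)
relativize-∀ true  true  true  _   t'≡t = t'≡t tt tt

any-cong : ∀ {A : Set} {f g : A → Bool} → (∀ x → f x ≡ g x) → ∀ xs → any f xs ≡ any g xs
any-cong f≗g xs = cong or (map-cong f≗g xs)

all-cong : ∀ {A : Set} {f g : A → Bool} → (∀ x → f x ≡ g x) → ∀ xs → all f xs ≡ all g xs
all-cong f≗g xs = cong and (map-cong f≗g xs)

lookup-AllPairs : ∀ {A : Set} {R : A → A → Set} {xs} → AllPairs R xs →
  ∀ {i j : Fin (length xs)} → i Fin.< j → R (lookup xs i) (lookup xs j)
lookup-AllPairs (Rx ∷ _)   {zero}  {suc j} _         = All.lookup Rx (∈-lookup j)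
lookup-AllPairs (_  ∷ Rxs) {suc i} {suc j} (s≤s i<j) = lookup-AllPairs Rxs i<j

module _ {A B : Set} (_≟_ : DecidableEquality A) (τ : B → A) where

  fibre : A → List B → List B
  fibre a = filter (λ x → τ x ≟ a)

  private
    avoiding : A → List B → List B
    avoiding a = filter (λ x → ¬? (τ x ≟ a))

    length-split : ∀ a xs → length xs ≡ length (fibre a xs) + length (avoiding a xs)
    length-split a []       = refl
    length-split a (x ∷ xs) with τ x ≟ a
    ... | yes _ = cong suc (length-split a xs)
    ... | no  _ = trans (cong suc (length-split a xs)) (sym (ℕ.+-suc _ _))

    fibre-avoiding : ∀ a b xs → length (fibre b (avoiding a xs)) ≤ length (fibre b xs)
    fibre-avoiding a b xs =
      length-mono-≤ (filter⁺ (λ x → τ x ≟ b) (λ x → τ x ≟ b) (λ { refl τx≡b → τx≡b })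
                             (filter-⊆ (λ x → ¬? (τ x ≟ a)) xs))

    fibre-nonempty : ∀ {x xs} → x ∈ xs → 0 < length (fibre (τ x) xs)
    fibre-nonempty x∈xs = filter-some (λ y → τ y ≟ _) (Any.map (λ { refl → refl }) x∈xs)

    overfull-or-outside : ∀ (p : A → ℕ) as xs → sum (map p as) < length xs →
      (∃ λ a → p a < length (fibre a xs)) ⊎ (∃ λ x → x ∈ xs × τ x ∉ as)
    overfull-or-outside p []       (x ∷ xs) _ = inj₂ (x , here refl , λ ())
    overfull-or-outside p (a ∷ as) xs sum<len with p a <? length (fibre a xs)
    ... | yes overfull = inj₁ (a , overfull)
    ... | no ¬overfull with overfull-or-outside p as (avoiding a xs) rest
      where
      rest : sum (map p as) < length (avoiding a xs)
      rest = ℕ.+-cancelˡ-< (p a) _ _ (ℕ.<-≤-trans (subst (_ <_) (length-split a xs) sum<len)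
               (ℕ.+-monoˡ-≤ (length (avoiding a xs)) (ℕ.≮⇒≥ ¬overfull)))
    ... | inj₁ (b , overfull)     = inj₁ (b , ℕ.<-≤-trans overfull (fibre-avoiding a b xs))
    ... | inj₂ (x , x∈ , outside) with ∈-filter⁻ (λ x → ¬? (τ x ≟ a)) x∈
    ... | x∈xs , τx≢a =
      inj₂ (x , x∈xs , λ { (here τx≡a) → τx≢a τx≡a ; (there τx∈as) → outside τx∈as })

  pigeonhole : ∀ (p : A → ℕ) supp → (∀ a → a ∉ supp → p a ≡ 0) →
    ∀ xs → sum (map p supp) < length xs → ∃ λ a → p a < length (fibre a xs)
  pigeonhole p supp outside xs sum<len with overfull-or-outside p supp xs sum<len
  ... | inj₁ overfull             = overfull
  ... | inj₂ (x , x∈xs , τx∉supp) =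
    τ x , subst (_< _) (sym (outside (τ x) τx∉supp)) (fibre-nonempty x∈xs)

-- Integer intervals of a cover

-- The interval inequalities below are all proved this way: a ring identity
-- exhibits y - x as a sum of terms known to be nonnegative.
≤-by-diff : ∀ {x y} z → y -ℤ x ≡ z → 0ℤ ≤ℤ z → x ≤ℤ y
≤-by-diff z y-x≡z 0≤z = ℤ.0≤i-j⇒j≤i (subst (0ℤ ≤ℤ_) (sym y-x≡z) 0≤z)

¬0≤-1 : ¬ 0ℤ ≤ℤ -1ℤ
¬0≤-1 ()

∣i∣≤⇒i≤ : ∀ i {d} → ∣ i ∣ ≤ d → i ≤ℤ + d
∣i∣≤⇒i≤ (+ k)    k≤d = +≤+ k≤d
∣i∣≤⇒i≤ -[1+ k ] _   = -≤+

∣a-b∣≤⇒a≤b+ : ∀ a b {d} → ∣ a -ℤ b ∣ ≤ d → a ≤ℤ b +ℤ + d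
∣a-b∣≤⇒a≤b+ a b {d} near =
  ≤-by-diff (+ d -ℤ (a -ℤ b)) (rearrange a b (+ d)) (ℤ.i≤j⇒0≤j-i (∣i∣≤⇒i≤ (a -ℤ b) near))
  where
  rearrange : ∀ a b d → (b +ℤ d) -ℤ a ≡ d -ℤ (a -ℤ b)
  rearrange = solve-∀

∣a-b∣≤⇒b≤a+ : ∀ a b {d} → ∣ a -ℤ b ∣ ≤ d → b ≤ℤ a +ℤ + d
∣a-b∣≤⇒b≤a+ a b near = ∣a-b∣≤⇒a≤b+ b a (subst (_≤ _) (ℤ.∣i-j∣≡∣j-i∣ a b) near)

∣i-k∣≤∣i-j∣+∣j-k∣ : ∀ i j k → ∣ i -ℤ k ∣ ≤ ∣ i -ℤ j ∣ + ∣ j -ℤ k ∣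
∣i-k∣≤∣i-j∣+∣j-k∣ i j k =
  subst (λ x → ∣ x ∣ ≤ ∣ i -ℤ j ∣ + ∣ j -ℤ k ∣) (telescope i j k) (ℤ.∣i+j∣≤∣i∣+∣j∣ (i -ℤ j) (j -ℤ k))
  where
  telescope : ∀ i j k → (i -ℤ j) +ℤ (j -ℤ k) ≡ i -ℤ k
  telescope = solve-∀

-- The period of the cover is the truncated difference ℓ ∸ 2r; 2r ≤ ℓ makes it exact.
period-split : ∀ {ℓ r} → 2 * r ≤ ℓ → + ℓ ≡ + (ℓ ∸ 2 * r) +ℤ + (2 * r)
period-split {ℓ} {r} 2r≤ℓ = trans (cong +_ (sym (ℕ.m∸n+n≡m 2r≤ℓ))) (ℤ.pos-+ (ℓ ∸ 2 * r) (2 * r))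

+[2*r]≡r+r : ∀ r → + (2 * r) ≡ + r +ℤ + r
+[2*r]≡r+r r = trans (ℤ.pos-+ r (r + 0)) (cong (λ k → + r +ℤ + k) (ℕ.+-identityʳ r))

inIv⁺ : ∀ lo hi z → lo ≤ℤ z → z ≤ℤ hi → T (inIv lo hi z)
inIv⁺ lo hi z lo≤z z≤hi = from (T-∧ {⌊ lo ≤? z ⌋}) (fromWitness lo≤z , fromWitness z≤hi)

inIv⁻ : ∀ lo hi z → T (inIv lo hi z) → lo ≤ℤ z × z ≤ℤ hi
inIv⁻ lo hi z h = let lo≤z , z≤hi = to (T-∧ {⌊ lo ≤? z ⌋}) h in toWitness lo≤z , toWitness z≤hi

module Cover (ℓ r : ℕ) (n : ℤ) where

  coverIv⁺ : ∀ t a → coverStart ℓ r n t ≤ℤ a → a ≤ℤ coverStart ℓ r n t +ℤ + ℓ -ℤ 1ℤ →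
    T (coverIv ℓ r n t a)
  coverIv⁺ t a = inIv⁺ _ _ a

  coverMid⁺ : ∀ t d a → coverStart ℓ r n t +ℤ + d ≤ℤ a → a ≤ℤ coverStart ℓ r n t +ℤ + ℓ -ℤ + d -ℤ 1ℤ →
    T (coverMid ℓ r n t d a)
  coverMid⁺ t d a = inIv⁺ _ _ a

  coverMid⁻ : ∀ t d a → T (coverMid ℓ r n t d a) →
    coverStart ℓ r n t +ℤ + d ≤ℤ a × a ≤ℤ coverStart ℓ r n t +ℤ + ℓ -ℤ + d -ℤ 1ℤ
  coverMid⁻ t d a = inIv⁻ _ _ a

  coverMid⇒coverIv : ∀ t {e d} a b → d ≤ e → T (coverMid ℓ r n t e a) → ∣ a -ℤ b ∣ ≤ d →
    T (coverIv ℓ r n t b)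
  coverMid⇒coverIv t {e} {d} a b d≤e a∈M near =
    coverIv⁺ t b
      (≤-by-diff _ (lower s a b (+ e) (+ d))
        (ℤ.+-mono-≤ (ℤ.+-mono-≤ (ℤ.i≤j⇒0≤j-i (∣a-b∣≤⇒a≤b+ a b near)) (ℤ.i≤j⇒0≤j-i lo≤a)) 0≤e-d))
      (≤-by-diff _ (upper s a b (+ e) (+ d) (+ ℓ))
        (ℤ.+-mono-≤ (ℤ.+-mono-≤ (ℤ.i≤j⇒0≤j-i (∣a-b∣≤⇒b≤a+ a b near)) (ℤ.i≤j⇒0≤j-i a≤hi)) 0≤e-d))
    where
    s : ℤ
    s = coverStart ℓ r n t
    lo≤a : s +ℤ + e ≤ℤ a
    lo≤a = proj₁ (coverMid⁻ t e a a∈M)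
    a≤hi : a ≤ℤ s +ℤ + ℓ -ℤ + e -ℤ 1ℤ
    a≤hi = proj₂ (coverMid⁻ t e a a∈M)
    0≤e-d : 0ℤ ≤ℤ + e -ℤ + d
    0≤e-d = ℤ.i≤j⇒0≤j-i (+≤+ d≤e)
    lower : ∀ s a b e d → b -ℤ s ≡ ((b +ℤ d) -ℤ a) +ℤ (a -ℤ (s +ℤ e)) +ℤ (e -ℤ d)
    lower = solve-∀
    upper : ∀ s a b e d l →
      (s +ℤ l -ℤ 1ℤ) -ℤ b ≡ ((a +ℤ d) -ℤ b) +ℤ ((s +ℤ l -ℤ e -ℤ 1ℤ) -ℤ a) +ℤ (e -ℤ d)
    upper = solve-∀

  coverMid-gap : ∀ {t t'} a b → 2 * r ≤ ℓ → t <ℤ t' →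
    T (coverMid ℓ r n t (2 * r) a) → T (coverMid ℓ r n t' (2 * r) b) → ¬ b ≤ℤ a +ℤ + (2 * r)
  coverMid-gap {t} {t'} a b 2r≤ℓ t<t' a∈M b∈M b≤a+2r =
    ¬0≤-1 (subst (0ℤ ≤ℤ_) (telescope n t t' (+ (ℓ ∸ 2 * r)) (+ (2 * r)) a b)
      (ℤ.+-mono-≤ (ℤ.+-mono-≤ (ℤ.+-mono-≤ (ℤ.i≤j⇒0≤j-i b≤a+2r) (ℤ.i≤j⇒0≤j-i lo≤b))
                              (ℤ.i≤j⇒0≤j-i a≤hi))
                  (ℤ.*-monoʳ-≤-nonNeg (+ (ℓ ∸ 2 * r)) (ℤ.i≤j⇒0≤j-i (ℤ.i<j⇒suc[i]≤j t<t')))))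
    where
    lo≤b : coverStart ℓ r n t' +ℤ + (2 * r) ≤ℤ b
    lo≤b = proj₁ (coverMid⁻ t' (2 * r) b b∈M)
    a≤hi : a ≤ℤ n +ℤ t *ℤ + (ℓ ∸ 2 * r) +ℤ (+ (ℓ ∸ 2 * r) +ℤ + (2 * r)) -ℤ + (2 * r) -ℤ 1ℤ
    a≤hi = subst (λ l → a ≤ℤ n +ℤ t *ℤ + (ℓ ∸ 2 * r) +ℤ l -ℤ + (2 * r) -ℤ 1ℤ) (period-split {ℓ} {r} 2r≤ℓ)
                 (proj₂ (coverMid⁻ t (2 * r) a a∈M))
    telescope : ∀ n t t' L R a b →
      ((a +ℤ R) -ℤ b) +ℤ (b -ℤ (n +ℤ t' *ℤ L +ℤ R)) +ℤ ((n +ℤ t *ℤ L +ℤ (L +ℤ R) -ℤ R -ℤ 1ℤ) -ℤ a)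
        +ℤ (t' -ℤ (1ℤ +ℤ t)) *ℤ L ≡ -1ℤ
    telescope = solve-∀

  coverMid-apart : ∀ {t t'} a b → 2 * r ≤ ℓ → t ≢ t' →
    T (coverMid ℓ r n t (2 * r) a) → T (coverMid ℓ r n t' (2 * r) b) → ¬ ∣ a -ℤ b ∣ ≤ 2 * r
  coverMid-apart {t} {t'} a b 2r≤ℓ t≢t' a∈M b∈M near with ℤ.<-cmp t t'
  ... | tri< t<t' _ _ = coverMid-gap a b 2r≤ℓ t<t' a∈M b∈M (∣a-b∣≤⇒b≤a+ a b near)
  ... | tri≈ _ t≡t' _ = t≢t' t≡t'
  ... | tri> _ _ t>t' = coverMid-gap b a 2r≤ℓ t>t' b∈M a∈M (∣a-b∣≤⇒a≤b+ a b near)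

  -- Each M_r(I_t) has exactly the period ℓ ∸ 2r as length, so they tile ℤ.
  coverMid-covers : 2 * r < ℓ → ∀ a → ∃ λ t → T (coverMid ℓ r n t r a)
  coverMid-covers 2r<ℓ a =
    q , coverMid⁺ q r a (≤-by-diff (+ rem) lower (+≤+ z≤n))
                        (≤-by-diff (+ L -ℤ (1ℤ +ℤ + rem)) upper (ℤ.i≤j⇒0≤j-i (+≤+ rem<L)))
    where
    open ≡-Reasoning
    L : ℕ
    L = ℓ ∸ 2 * r
    instance
      L≢0 : NonZero L
      L≢0 = >-nonZero (ℕ.m<n⇒0<n∸m 2r<ℓ)
    x q : ℤ
    x = a -ℤ n -ℤ + r
    q = x /ℕ L
    rem : ℕ
    rem = x %ℕ L
    rem<L : rem < L
    rem<L = n%ℕd<d x L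
    x≡rem+qL : x ≡ + rem +ℤ q *ℤ + L
    x≡rem+qL = a≡a%ℕn+[a/ℕn]*n x L
    lower : a -ℤ (n +ℤ q *ℤ + L +ℤ + r) ≡ + rem
    lower = begin
      a -ℤ (n +ℤ q *ℤ + L +ℤ + r)    ≡⟨ shift a n (+ r) q (+ L) ⟩
      x -ℤ q *ℤ + L                  ≡⟨ cong (_-ℤ q *ℤ + L) x≡rem+qL ⟩
      + rem +ℤ q *ℤ + L -ℤ q *ℤ + L  ≡⟨ cancel (+ rem) q (+ L) ⟩
      + rem                          ∎
      where
      shift : ∀ a n r q L → a -ℤ (n +ℤ q *ℤ L +ℤ r) ≡ a -ℤ n -ℤ r -ℤ q *ℤ L
      shift = solve-∀
      cancel : ∀ m q L → m +ℤ q *ℤ L -ℤ q *ℤ L ≡ m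
      cancel = solve-∀
    upper : n +ℤ q *ℤ + L +ℤ + ℓ -ℤ + r -ℤ 1ℤ -ℤ a ≡ + L -ℤ (1ℤ +ℤ + rem)
    upper = begin
      n +ℤ q *ℤ + L +ℤ + ℓ -ℤ + r -ℤ 1ℤ -ℤ a
        ≡⟨ cong (λ l → n +ℤ q *ℤ + L +ℤ l -ℤ + r -ℤ 1ℤ -ℤ a)
                (trans (period-split {ℓ} {r} (ℕ.<⇒≤ 2r<ℓ)) (cong (+ L +ℤ_) (+[2*r]≡r+r r))) ⟩
      n +ℤ q *ℤ + L +ℤ (+ L +ℤ (+ r +ℤ + r)) -ℤ + r -ℤ 1ℤ -ℤ a
        ≡⟨ shift a n (+ r) q (+ L) ⟩
      + L -ℤ (1ℤ +ℤ (x -ℤ q *ℤ + L))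
        ≡⟨ cong (λ y → + L -ℤ (1ℤ +ℤ (y -ℤ q *ℤ + L))) x≡rem+qL ⟩
      + L -ℤ (1ℤ +ℤ (+ rem +ℤ q *ℤ + L -ℤ q *ℤ + L))
        ≡⟨ cancel (+ L) (+ rem) q ⟩
      + L -ℤ (1ℤ +ℤ + rem) ∎
      where
      shift : ∀ a n r q L →
        n +ℤ q *ℤ L +ℤ (L +ℤ (r +ℤ r)) -ℤ r -ℤ 1ℤ -ℤ a ≡ L -ℤ (1ℤ +ℤ (a -ℤ n -ℤ r -ℤ q *ℤ L))
      shift = solve-∀
      cancel : ∀ L m q → L -ℤ (1ℤ +ℤ (m +ℤ q *ℤ L -ℤ q *ℤ L)) ≡ L -ℤ (1ℤ +ℤ m)
      cancel = solve-∀

-- Walks and satisfaction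

Step : ∀ {V : ℕ} → (Fin V → Fin V → Bool) → Fin V → Fin V → Set
Step adj w v = w ≡ v ⊎ T (adj w v)

-- The reading of d(u, v) ≤ d: d steps, each staying put or following an edge.  As in
-- dist≤ , every vertex of the walk except the last one must satisfy inV.
data Walk {V : ℕ} (inV : Fin V → Bool) (adj : Fin V → Fin V → Bool) : ℕ → Fin V → Fin V → Set where
  stop : ∀ {u v} → u ≡ v → Walk inV adj 0 u v
  step : ∀ {d u v} w → T (inV w) → Walk inV adj d u w → Step adj w v → Walk inV adj (suc d) u v

Walk[_] : ∀ {U} (G : Str U) → ℕ → Fin (N G) → Fin (N G) → Set
Walk[ G ] = Walk (dom G) (adj G)

walk-weaken : ∀ {V} {D D' : Fin V → Bool} {A d u v} → (∀ {w} → T (D w) → T (D' w)) →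
  Walk D A d u v → Walk D' A d u v
walk-weaken D⊆D' (stop u≡v)           = stop u≡v
walk-weaken D⊆D' (step w dw walk last) = step w (D⊆D' dw) (walk-weaken D⊆D' walk) last

extEnv-cong : ∀ {A : Set} {n} (a : A) {ρ σ : Fin n → A} → (∀ i → ρ i ≡ σ i) →
  ∀ i → extEnv a ρ i ≡ extEnv a σ i
extEnv-cong a ρ≗σ zero    = refl
extEnv-cong a ρ≗σ (suc i) = ρ≗σ i

extEnv-liftRen : ∀ {A : Set} {n m} (a : A) (f : Fin n → Fin m) {ρ : Fin m → A} {σ : Fin n → A} →
  (∀ i → ρ (f i) ≡ σ i) → ∀ i → extEnv a ρ (liftRen f i) ≡ extEnv a σ i
extEnv-liftRen a f ρf≗σ zero    = refl
extEnv-liftRen a f ρf≗σ (suc i) = ρf≗σ i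

extEnv-η : ∀ {A : Set} {n} (ρ : Fin (suc n) → A) i → extEnv (ρ zero) (λ i → ρ (suc i)) i ≡ ρ i
extEnv-η ρ zero    = refl
extEnv-η ρ (suc i) = refl

module _ {U : Set} (G : Str U) where

  Env : ℕ → Set
  Env n = Fin n → Fin (N G)

  sat-∃⁺ : ∀ {n} (φ : Fm U (suc n)) (ρ : Env n) v →
    T (dom G v) → T (sat G φ (extEnv v ρ)) → T (sat G (∃' φ) ρ)
  sat-∃⁺ φ ρ v dv φv =
    any⁺ (λ v → dom G v ∧ sat G φ (extEnv v ρ)) (lose (∈-allFin v) (from T-∧ (dv , φv)))

  sat-∃⁻ : ∀ {n} (φ : Fm U (suc n)) (ρ : Env n) →
    T (sat G (∃' φ) ρ) → ∃ λ v → T (dom G v) × T (sat G φ (extEnv v ρ))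
  sat-∃⁻ φ ρ h =
    let v , p = satisfied (any⁻ (λ v → dom G v ∧ sat G φ (extEnv v ρ)) (allFin (N G)) h)
    in v , to T-∧ p

  sat-∀⁺ : ∀ {n} (φ : Fm U (suc n)) (ρ : Env n) →
    (∀ v → T (dom G v) → T (sat G φ (extEnv v ρ))) → T (sat G (∀' φ) ρ)
  sat-∀⁺ φ ρ h =
    all⁻ (λ v → not (dom G v) ∨ sat G φ (extEnv v ρ)) (All.universal (λ v → T-⇒⁺ (h v)) (allFin (N G)))

  sat-∀⁻ : ∀ {n} (φ : Fm U (suc n)) (ρ : Env n) →
    T (sat G (∀' φ) ρ) → ∀ v → T (dom G v) → T (sat G φ (extEnv v ρ))
  sat-∀⁻ φ ρ h v =
    T-⇒⁻ (All.lookup (all⁺ (λ v → not (dom G v) ∨ sat G φ (extEnv v ρ)) (allFin (N G)) h) (∈-allFin v))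

  sat-cong : ∀ {n} (φ : Fm U n) {ρ σ : Env n} → (∀ i → ρ i ≡ σ i) → sat G φ ρ ≡ sat G φ σ
  sat-cong (E i j)  ρ≗σ = cong₂ (adj G) (ρ≗σ i) (ρ≗σ j)
  sat-cong (Eq i j) ρ≗σ = cong₂ (λ u v → ⌊ u Fin.≟ v ⌋) (ρ≗σ i) (ρ≗σ j)
  sat-cong (P u i)  ρ≗σ = cong (pred G u) (ρ≗σ i)
  sat-cong ⊤'       ρ≗σ = refl
  sat-cong ⊥'       ρ≗σ = refl
  sat-cong (¬' φ)   ρ≗σ = cong not (sat-cong φ ρ≗σ)
  sat-cong (φ ∧' ψ) ρ≗σ = cong₂ _∧_ (sat-cong φ ρ≗σ) (sat-cong ψ ρ≗σ)
  sat-cong (φ ∨' ψ) ρ≗σ = cong₂ _∨_ (sat-cong φ ρ≗σ) (sat-cong ψ ρ≗σ)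
  sat-cong (φ ⇒' ψ) ρ≗σ = cong₂ (λ a b → not a ∨ b) (sat-cong φ ρ≗σ) (sat-cong ψ ρ≗σ)
  sat-cong (∃' φ)   ρ≗σ =
    any-cong (λ v → cong (dom G v ∧_) (sat-cong φ (extEnv-cong v ρ≗σ))) (allFin (N G))
  sat-cong (∀' φ)   ρ≗σ =
    all-cong (λ v → cong (not (dom G v) ∨_) (sat-cong φ (extEnv-cong v ρ≗σ))) (allFin (N G))

  sat-rename : ∀ {n m} (φ : Fm U n) (f : Fin n → Fin m) {ρ : Env m} {σ : Env n} →
    (∀ i → ρ (f i) ≡ σ i) → sat G (rename f φ) ρ ≡ sat G φ σ
  sat-rename (E i j)  f ρf≗σ = cong₂ (adj G) (ρf≗σ i) (ρf≗σ j)
  sat-rename (Eq i j) f ρf≗σ = cong₂ (λ u v → ⌊ u Fin.≟ v ⌋) (ρf≗σ i) (ρf≗σ j)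
  sat-rename (P u i)  f ρf≗σ = cong (pred G u) (ρf≗σ i)
  sat-rename ⊤'       f ρf≗σ = refl
  sat-rename ⊥'       f ρf≗σ = refl
  sat-rename (¬' φ)   f ρf≗σ = cong not (sat-rename φ f ρf≗σ)
  sat-rename (φ ∧' ψ) f ρf≗σ = cong₂ _∧_ (sat-rename φ f ρf≗σ) (sat-rename ψ f ρf≗σ)
  sat-rename (φ ∨' ψ) f ρf≗σ = cong₂ _∨_ (sat-rename φ f ρf≗σ) (sat-rename ψ f ρf≗σ)
  sat-rename (φ ⇒' ψ) f ρf≗σ = cong₂ (λ a b → not a ∨ b) (sat-rename φ f ρf≗σ) (sat-rename ψ f ρf≗σ)
  sat-rename (∃' φ)   f ρf≗σ = any-cong (λ v →
    cong (dom G v ∧_) (sat-rename φ (liftRen f) (extEnv-liftRen v f ρf≗σ))) (allFin (N G))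
  sat-rename (∀' φ)   f ρf≗σ = all-cong (λ v →
    cong (not (dom G v) ∨_) (sat-rename φ (liftRen f) (extEnv-liftRen v f ρf≗σ))) (allFin (N G))

  sat-inst : ∀ {k} (φ : Fm U 1) (i : Fin k) (ρ : Env k) → sat G (inst φ i) ρ ≡ sat G φ (λ _ → ρ i)
  sat-inst φ i ρ = sat-rename φ (λ _ → i) (λ _ → refl)

  sat-extend-old : ∀ {n} (A B : Fin (N G) → Bool) (φ : Fm U n) (ρ : Env n) →
    sat (extend G A B) (mapSym old φ) ρ ≡ sat G φ ρ
  sat-extend-old A B (E i j)  ρ = refl
  sat-extend-old A B (Eq i j) ρ = refl
  sat-extend-old A B (P u i)  ρ = refl
  sat-extend-old A B ⊤'       ρ = refl
  sat-extend-old A B ⊥'       ρ = refl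
  sat-extend-old A B (¬' φ)   ρ = cong not (sat-extend-old A B φ ρ)
  sat-extend-old A B (φ ∧' ψ) ρ = cong₂ _∧_ (sat-extend-old A B φ ρ) (sat-extend-old A B ψ ρ)
  sat-extend-old A B (φ ∨' ψ) ρ = cong₂ _∨_ (sat-extend-old A B φ ρ) (sat-extend-old A B ψ ρ)
  sat-extend-old A B (φ ⇒' ψ) ρ =
    cong₂ (λ a b → not a ∨ b) (sat-extend-old A B φ ρ) (sat-extend-old A B ψ ρ)
  sat-extend-old A B (∃' φ)   ρ =
    any-cong (λ v → cong (dom G v ∧_) (sat-extend-old A B φ (extEnv v ρ))) (allFin (N G))
  sat-extend-old A B (∀' φ)   ρ =
    all-cong (λ v → cong (not (dom G v) ∨_) (sat-extend-old A B φ (extEnv v ρ))) (allFin (N G))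

  sat-dist≤⁻ : ∀ d {n} (i j : Fin n) (ρ : Env n) → T (sat G (dist≤ d i j) ρ) → Walk[ G ] d (ρ i) (ρ j)
  sat-dist≤⁻ zero    i j ρ h = stop (toWitness h)
  sat-dist≤⁻ (suc d) i j ρ h =
    let w , dw , body = sat-∃⁻ (dist≤ d (suc i) zero ∧' (Eq zero (suc j) ∨' E zero (suc j))) ρ h
        walk , last = to T-∧ body
    in step w dw (sat-dist≤⁻ d (suc i) zero (extEnv w ρ) walk) (lastStep (to T-∨ last))
    where
    lastStep : ∀ {w} → T ⌊ w Fin.≟ ρ j ⌋ ⊎ T (adj G w (ρ j)) → Step (adj G) w (ρ j)
    lastStep (inj₁ w≡v) = inj₁ (toWitness w≡v)
    lastStep (inj₂ wv)  = inj₂ wv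

  sat-dist≤⁺ : ∀ d {n} (i j : Fin n) (ρ : Env n) → Walk[ G ] d (ρ i) (ρ j) → T (sat G (dist≤ d i j) ρ)
  sat-dist≤⁺ zero    i j ρ (stop u≡v) = fromWitness u≡v
  sat-dist≤⁺ (suc d) i j ρ (step w dw walk last) =
    sat-∃⁺ (dist≤ d (suc i) zero ∧' (Eq zero (suc j) ∨' E zero (suc j))) ρ w dw
      (from T-∧ (sat-dist≤⁺ d (suc i) zero (extEnv w ρ) walk , from T-∨ (lastStep last)))
    where
    lastStep : Step (adj G) w (ρ j) → T ⌊ w Fin.≟ ρ j ⌋ ⊎ T (adj G w (ρ j))
    lastStep (inj₁ w≡v) = inj₁ (fromWitness w≡v)
    lastStep (inj₂ wv)  = inj₂ wv

  sat-bigAnd⁺ : ∀ {n} k (f : Fin k → Fm U n) (ρ : Env n) →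
    (∀ i → T (sat G (f i) ρ)) → T (sat G (bigAnd k f) ρ)
  sat-bigAnd⁺ zero    f ρ h = tt
  sat-bigAnd⁺ (suc k) f ρ h = from T-∧ (h zero , sat-bigAnd⁺ k (λ i → f (suc i)) ρ (λ i → h (suc i)))

  sat-bigAnd⁻ : ∀ {n} k (f : Fin k → Fm U n) (ρ : Env n) →
    T (sat G (bigAnd k f) ρ) → ∀ i → T (sat G (f i) ρ)
  sat-bigAnd⁻ (suc k) f ρ h zero    = proj₁ (to T-∧ h)
  sat-bigAnd⁻ (suc k) f ρ h (suc i) = sat-bigAnd⁻ k (λ i → f (suc i)) ρ (proj₂ (to T-∧ h)) i

  sat-bigOr⁺ : ∀ {n} k (f : Fin k → Fm U n) (ρ : Env n) i →
    T (sat G (f i) ρ) → T (sat G (bigOr k f) ρ)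
  sat-bigOr⁺ (suc k) f ρ zero    h = from T-∨ (inj₁ h)
  sat-bigOr⁺ (suc k) f ρ (suc i) h = from T-∨ (inj₂ (sat-bigOr⁺ k (λ i → f (suc i)) ρ i h))

  sat-bigOr⁻ : ∀ {n} k (f : Fin k → Fm U n) (ρ : Env n) →
    T (sat G (bigOr k f) ρ) → ∃ λ i → T (sat G (f i) ρ)
  sat-bigOr⁻ (suc k) f ρ h with to T-∨ h
  ... | inj₁ h₀ = zero , h₀
  ... | inj₂ hs = let i , hi = sat-bigOr⁻ k (λ i → f (suc i)) ρ hs in suc i , hi

  Far : ℕ → ∀ k → Env k → Set
  Far D k ρ = ∀ {i j : Fin k} → i Fin.< j → ¬ Walk[ G ] D (ρ i) (ρ j)

  sat-pairwiseFar⁺ : ∀ r k (ρ : Env k) → Far (2 * r) k ρ → T (sat G (pairwiseFar r k) ρ)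
  sat-pairwiseFar⁺ r k ρ far = sat-bigAnd⁺ k _ ρ λ i → sat-bigAnd⁺ k _ ρ λ j → farPair i j
    where
    farPair : ∀ i j → T (sat G (if toℕ i <ᵇ toℕ j then ¬' dist≤ (2 * r) i j else ⊤') ρ)
    farPair i j with toℕ i <ᵇ toℕ j in i<ᵇj
    ... | true  = T-not⁺ λ near →
                    far (ℕ.<ᵇ⇒< _ _ (subst T (sym i<ᵇj) tt)) (sat-dist≤⁻ (2 * r) i j ρ near)
    ... | false = tt

  sat-pairwiseFar⁻ : ∀ r k (ρ : Env k) → T (sat G (pairwiseFar r k) ρ) → Far (2 * r) k ρ
  sat-pairwiseFar⁻ r k ρ h {i} {j} i<j walk =
    farPair (sat-bigAnd⁻ k _ ρ (sat-bigAnd⁻ k _ ρ h i) j) (sat-dist≤⁺ (2 * r) i j ρ walk)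
    where
    farPair : T (sat G (if toℕ i <ᵇ toℕ j then ¬' dist≤ (2 * r) i j else ⊤') ρ) →
              ¬ T (sat G (dist≤ (2 * r) i j) ρ)
    farPair with toℕ i <ᵇ toℕ j | ℕ.<⇒<ᵇ i<j
    ... | true | _ = T-not⁻

  sat-exs⁺ : ∀ k (φ : Fm U k) (ρ : Env k) → (∀ i → T (dom G (ρ i))) → T (sat G φ ρ) → G ⊨ exs k φ
  sat-exs⁺ zero    φ ρ _  h = subst T (sat-cong φ λ ()) h
  sat-exs⁺ (suc k) φ ρ dρ h =
    sat-exs⁺ k (∃' φ) (λ i → ρ (suc i)) (λ i → dρ (suc i))
      (sat-∃⁺ φ (λ i → ρ (suc i)) (ρ zero) (dρ zero) (subst T (sat-cong φ λ i → sym (extEnv-η ρ i)) h))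

  sat-exs⁻ : ∀ k (φ : Fm U k) → G ⊨ exs k φ →
    ∃ λ (ρ : Env k) → (∀ i → T (dom G (ρ i))) × T (sat G φ ρ)
  sat-exs⁻ zero    φ h = (λ ()) , (λ ()) , h
  sat-exs⁻ (suc k) φ h =
    let ρ , dρ , ∃φ = sat-exs⁻ k (∃' φ) h
        v , dv , φv = sat-∃⁻ φ ρ ∃φ
    in extEnv v ρ , (λ { zero → dv ; (suc i) → dρ i }) , φv

  sat-alls⁺ : ∀ k (φ : Fm U k) →
    (∀ (ρ : Env k) → (∀ i → T (dom G (ρ i))) → T (sat G φ ρ)) → G ⊨ alls k φ
  sat-alls⁺ zero    φ h = h (λ ()) (λ ())
  sat-alls⁺ (suc k) φ h =
    sat-alls⁺ k (∀' φ) λ ρ dρ → sat-∀⁺ φ ρ λ v dv → h (extEnv v ρ) λ { zero → dv ; (suc i) → dρ i }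

  sat-alls⁻ : ∀ k (φ : Fm U k) → G ⊨ alls k φ →
    ∀ (ρ : Env k) → (∀ i → T (dom G (ρ i))) → T (sat G φ ρ)
  sat-alls⁻ zero    φ h ρ _  = subst T (sat-cong φ λ ()) h
  sat-alls⁻ (suc k) φ h ρ dρ =
    subst T (sat-cong φ (extEnv-η ρ))
      (sat-∀⁻ φ (λ i → ρ (suc i)) (sat-alls⁻ k (∀' φ) h (λ i → ρ (suc i)) (λ i → dρ (suc i)))
              (ρ zero) (dρ zero))

  step-sym : ∀ {w v} → Step (adj G) w v → Step (adj G) v w
  step-sym (inj₁ w≡v) = inj₁ (sym w≡v)
  step-sym (inj₂ wv)  = inj₂ (subst T (adj-sym G _ _) wv)

  walk-cons : ∀ {d u w v} → T (dom G u) → Step (adj G) u w → Walk[ G ] d w v → Walk[ G ] (suc d) u v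
  walk-cons du first (stop refl)           = step _ du (stop refl) first
  walk-cons du first (step x dx walk last) = step x dx (walk-cons du first walk) last

  walk-reverse : ∀ {d u v} → T (dom G v) → Walk[ G ] d u v → Walk[ G ] d v u
  walk-reverse dv (stop refl)           = stop refl
  walk-reverse dv (step w dw walk last) = walk-cons dv (step-sym last) (walk-reverse dw walk)

  far⇒apart : ∀ {D k} (ρ : Env k) → (∀ i → T (dom G (ρ i))) → Far D k ρ →
    ∀ {i j} → i ≢ j → ¬ Walk[ G ] D (ρ i) (ρ j)
  far⇒apart ρ dρ far {i} {j} i≢j walk with Fin.<-cmp i j
  ... | tri< i<j _ _ = far i<j walk
  ... | tri≈ _ i≡j _ = i≢j i≡j
  ... | tri> _ _ j<i = far j<i (walk-reverse (dρ j) walk)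

  walk-layer : ∀ (lay : Fin (N G) → ℤ) → IsLayering G lay → ∀ {d u v} → T (dom G u) → T (dom G v) →
    Walk[ G ] d u v → ∣ lay u -ℤ lay v ∣ ≤ d
  walk-layer lay layering du dv (stop refl) = ℕ.≤-reflexive (cong ∣_∣ (ℤ.+-inverseʳ (lay _)))
  walk-layer lay layering {suc d} {u} {v} du dv (step w dw walk last) = begin
    ∣ lay u -ℤ lay v ∣                       ≤⟨ ∣i-k∣≤∣i-j∣+∣j-k∣ (lay u) (lay w) (lay v) ⟩
    ∣ lay u -ℤ lay w ∣ + ∣ lay w -ℤ lay v ∣  ≤⟨ ℕ.+-mono-≤ (walk-layer lay layering du dw walk)
                                                           (lastLayer last) ⟩
    d + 1                                    ≡⟨ ℕ.+-comm d 1 ⟩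
    suc d                                    ∎
    where
    open ℕ.≤-Reasoning
    lastLayer : Step (adj G) w v → ∣ lay w -ℤ lay v ∣ ≤ 1
    lastLayer (inj₁ refl) = ℕ.≤-trans (ℕ.≤-reflexive (cong ∣_∣ (ℤ.+-inverseʳ (lay w)))) z≤n
    lastLayer (inj₂ wv)   = layering w v dw dv wv

  BallIn : ℕ → Fin (N G) → (Fin (N G) → Bool) → Set
  BallIn D x S = ∀ {d v} → d ≤ D → T (dom G v) → Walk[ G ] d x v → T (S v)

  walk-restrict : ∀ {D x S} → BallIn D x S → ∀ {d v} → d ≤ D →
    Walk[ G ] d x v → Walk[ induced G S ] d x v
  walk-restrict ball _   (stop x≡v)            = stop x≡v
  walk-restrict ball d<D (step w dw walk last) =
    step w (from T-∧ (dw , ball (ℕ.<⇒≤ d<D) dw walk)) (walk-restrict ball (ℕ.<⇒≤ d<D) walk) last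

  basic-existential-of-list : ∀ {r} (ψ : Fm U 1) ws → AllPairs (λ x y → ¬ Walk[ G ] (2 * r) x y) ws →
    All (λ x → T (dom G x) × T (sat G ψ (λ _ → x))) ws → G ⊨ basic existential (length ws) r ψ
  basic-existential-of-list {r} ψ ws apart good =
    sat-exs⁺ (length ws) _ (lookup ws) (λ i → proj₁ (good-at i))
      (from T-∧ (sat-pairwiseFar⁺ r _ (lookup ws) (lookup-AllPairs apart) ,
                 sat-bigAnd⁺ _ (inst ψ) (lookup ws) λ i →
                   subst T (sym (sat-inst ψ i (lookup ws))) (proj₂ (good-at i))))
    where
    good-at : ∀ i → T (dom G (lookup ws i)) × T (sat G ψ (λ _ → lookup ws i))
    good-at i = All.lookup good (∈-lookup i)

-- Locality

module _ {U : Set} (G : Str U) {r : ℕ} {S : Fin (N G) → Bool} where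

  private
    H : Str U
    H = induced G S

    guard : ∀ {n} → Fm U (suc (suc n))
    guard {n} = dist≤ r (fromℕ (suc n)) zero

  guard-agree : ∀ {n} (ρ : Env G (suc n)) → BallIn G r (ρ (fromℕ n)) S → ∀ v →
    sat H guard (extEnv v ρ) ≡ sat G guard (extEnv v ρ)
  guard-agree ρ ball v = T-injective
    (λ h → sat-dist≤⁺ G r _ zero (extEnv v ρ)
             (walk-weaken (λ dw → proj₁ (to T-∧ dw)) (sat-dist≤⁻ H r _ zero (extEnv v ρ) h)))
    (λ h → sat-dist≤⁺ H r _ zero (extEnv v ρ)
             (walk-restrict G ball ℕ.≤-refl (sat-dist≤⁻ G r _ zero (extEnv v ρ) h)))

  guarded-inS : ∀ {n} (ρ : Env G (suc n)) → BallIn G r (ρ (fromℕ n)) S → (∀ i → T (S (ρ i))) →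
    ∀ v → T (dom G v) → T (sat G guard (extEnv v ρ)) → ∀ i → T (S (extEnv v ρ i))
  guarded-inS ρ ball inS v dv near zero    = ball ℕ.≤-refl dv (sat-dist≤⁻ G r _ zero (extEnv v ρ) near)
  guarded-inS ρ ball inS v dv near (suc i) = inS i

  sat-induced-local : ∀ {n} {φ : Fm U (suc n)} → Local r φ → (ρ : Env G (suc n)) →
    BallIn G r (ρ (fromℕ n)) S → (∀ i → T (S (ρ i))) → sat H φ ρ ≡ sat G φ ρ
  sat-induced-local (E i j)   ρ ball inS = refl
  sat-induced-local (Eq i j)  ρ ball inS = refl
  sat-induced-local (P u i)   ρ ball inS =
    T-injective (λ h → proj₁ (to T-∧ h)) (λ h → from T-∧ (h , inS i))
  sat-induced-local ⊤'        ρ ball inS = refl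
  sat-induced-local ⊥'        ρ ball inS = refl
  sat-induced-local (¬' l)    ρ ball inS = cong not (sat-induced-local l ρ ball inS)
  sat-induced-local (l ∧' l') ρ ball inS =
    cong₂ _∧_ (sat-induced-local l ρ ball inS) (sat-induced-local l' ρ ball inS)
  sat-induced-local (l ∨' l') ρ ball inS =
    cong₂ _∨_ (sat-induced-local l ρ ball inS) (sat-induced-local l' ρ ball inS)
  sat-induced-local (l ⇒' l') ρ ball inS =
    cong₂ (λ a b → not a ∨ b) (sat-induced-local l ρ ball inS) (sat-induced-local l' ρ ball inS)
  sat-induced-local (∃loc {θ = θ} l) ρ ball inS = any-cong (λ v →
      trans (cong (λ g → (dom G v ∧ S v) ∧ (g ∧ sat H θ (extEnv v ρ))) (guard-agree ρ ball v))
            (relativize-∃ (dom G v) (S v) _ (λ dv near → guarded-inS ρ ball inS v dv near zero)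
               λ dv near → sat-induced-local l (extEnv v ρ) ball (guarded-inS ρ ball inS v dv near)))
    (allFin (N G))
  sat-induced-local (∀loc {θ = θ} l) ρ ball inS = all-cong (λ v →
      trans (cong (λ g → not (dom G v ∧ S v) ∨ (not g ∨ sat H θ (extEnv v ρ))) (guard-agree ρ ball v))
            (relativize-∀ (dom G v) (S v) _ (λ dv near → guarded-inS ρ ball inS v dv near zero)
               λ dv near → sat-induced-local l (extEnv v ρ) ball (guarded-inS ρ ball inS v dv near)))
    (allFin (N G))

-- Gluing the windows of a layered cover

module LayeredCover {k m : ℕ} (r' : ℕ) (ψ : Fm (Fin k) 1) (ψ-local : Local r' ψ)
    (G : Str (Fin k)) (lay : Fin (N G) → ℤ) (layering : IsLayering G lay)
    (r ℓ : ℕ) (r'≤r : r' ≤ r) (4r<ℓ : 4 * r < ℓ) (n : ℤ) (pl : Plan m) where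

  open Cover ℓ r n

  Block : ℤ → Fin (N G) → Bool
  Block t = preimage lay (coverIv ℓ r n t)

  Window : ℤ → Str (Ext (Fin k))
  Window t = extend (induced G (Block t)) (preimage lay (coverMid ℓ r n t (2 * r)))
                                          (preimage lay (coverMid ℓ r n t r))

  private
    2r<ℓ : 2 * r < ℓ
    2r<ℓ = ℕ.≤-<-trans (ℕ.*-monoˡ-≤ r (s≤s (s≤s (z≤n {2})))) 4r<ℓ

    2r'≤2r : 2 * r' ≤ 2 * r
    2r'≤2r = ℕ.*-monoʳ-≤ 2 r'≤r

    r'≤2r : r' ≤ 2 * r
    r'≤2r = ℕ.≤-trans r'≤r (ℕ.m≤m+n r (r + 0))

  record Central (e : ℕ) (t : ℤ) (x : Fin (N G)) : Set where
    constructor _,_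
    field
      in-domain : T (dom G x)
      in-middle : T (coverMid ℓ r n t e (lay x))

  ball-in-block : ∀ {d e t x} → d ≤ e → Central e t x → BallIn G d x (Block t)
  ball-in-block {t = t} {x} d≤e (dx , x∈M) {d'} {v} d'≤d dv walk =
    coverMid⇒coverIv t (lay x) (lay v) (ℕ.≤-trans d'≤d d≤e) x∈M (walk-layer G lay layering dx dv walk)

  central-in-block : ∀ {e t x} → Central e t x → T (Block t x)
  central-in-block c = ball-in-block z≤n c z≤n (Central.in-domain c) (stop refl)

  sat-window-core : ∀ {e t x} → r' ≤ e → Central e t x →
    sat (Window t) (mapSym old ψ) (λ _ → x) ≡ sat G ψ (λ _ → x)
  sat-window-core {t = t} {x} r'≤e c =
    trans (sat-extend-old (induced G (Block t)) _ _ ψ (λ _ → x))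
          (sat-induced-local G ψ-local (λ _ → x) (ball-in-block r'≤e c) (λ _ → central-in-block c))

  Apart : Fin (N G) → Fin (N G) → Set
  Apart x y = ¬ Walk[ G ] (2 * r') x y

  apart-across-blocks : ∀ {t t' x y} → t ≢ t' → Central (2 * r) t x → Central (2 * r) t' y → Apart x y
  apart-across-blocks {x = x} {y} t≢t' (dx , x∈M) (dy , y∈M) walk =
    coverMid-apart (lay x) (lay y) (ℕ.<⇒≤ 2r<ℓ) t≢t' x∈M y∈M
      (ℕ.≤-trans (walk-layer G lay layering dx dy walk) 2r'≤2r)

  Witness : ℤ → Fin (N G) → Set
  Witness t x = Central (2 * r) t x × T (sat G ψ (λ _ → x))

  window-witnesses : ∀ t K → Window t ⊨ variant existential K r' ψ →
    ∃ λ ws → length ws ≡ K × AllPairs Apart ws × All (Witness t) ws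
  window-witnesses t K h with sat-exs⁻ (Window t) K _ h
  ... | ρ , dρ , body =
    tabulate ρ , length-tabulate ρ , AllPairs.tabulate⁺-< apart , All.tabulate⁺ witness
    where
    witness : ∀ i → Witness t (ρ i)
    witness i =
      let inC , core = to T-∧ (sat-bigAnd⁻ (Window t) K _ ρ (proj₂ (to T-∧ body)) i)
          c = proj₁ (to T-∧ (dρ i)) , inC
      in c , subst T (trans (sat-inst (Window t) (mapSym old ψ) i ρ) (sat-window-core r'≤2r c)) core
    apart : ∀ {i j} → i Fin.< j → Apart (ρ i) (ρ j)
    apart {i} i<j walk =
      sat-pairwiseFar⁻ (Window t) r' K ρ (proj₁ (to T-∧ body)) i<j
        (walk-restrict G (ball-in-block 2r'≤2r (proj₁ (witness i))) ℕ.≤-refl walk)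

  all-witnesses : (∀ t → Window t ⊨ variant existential (p pl t) r' ψ) → ∀ ts → Unique ts →
    ∃ λ ws → length ws ≡ sum (map (p pl) ts) × AllPairs Apart ws ×
             All (λ x → ∃ λ t → t ∈ ts × Witness t x) ws
  all-witnesses hyp []       []            = [] , refl , [] , []
  all-witnesses hyp (t ∷ ts) (t∉ts ∷ uniq) =
    let bs , lenB , apartB , witB = window-witnesses t (p pl t) (hyp t)
        rs , lenR , apartR , witR = all-witnesses hyp ts uniq
    in bs ++ rs ,
       trans (length-++ bs) (cong₂ _+_ lenB lenR) ,
       AllPairs.++⁺ apartB apartR
         (All.map (λ wx → All.map (λ (_ , t'∈ts , wy) →
                    apart-across-blocks (All.lookup t∉ts t'∈ts) (proj₁ wx) (proj₁ wy)) witR) witB) ,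
       All.++⁺ (All.map (λ w → t , here refl , w) witB)
               (All.map (λ (t' , t'∈ts , w) → t' , there t'∈ts , w) witR)

  existential-case : (∀ t → Window t ⊨ variant existential (p pl t) r' ψ) → G ⊨ basic existential m r' ψ
  existential-case hyp =
    let ws , len , apart , wit = all-witnesses hyp (supp pl) (uniq pl)
    in subst (λ K → G ⊨ basic existential K r' ψ) (trans len (total pl))
         (basic-existential-of-list G {r'} ψ ws apart
           (All.map (λ (_ , _ , (dx , _) , ψx) → dx , ψx) wit))

  home : Fin (N G) → ℤ
  home x = proj₁ (coverMid-covers 2r<ℓ (lay x))

  home-central : ∀ {x} → T (dom G x) → Central r (home x) x
  home-central {x} dx = dx , proj₂ (coverMid-covers 2r<ℓ (lay x))

  budget<points : sum (map (p pl) (supp pl)) < length (allFin (suc m))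
  budget<points = subst₂ _<_ (sym (total pl)) (sym (length-tabulate (λ i → i))) (ℕ.n<1+n m)

  overfull-block : (ρ : Fin (suc m) → Fin (N G)) → (∀ i → T (dom G (ρ i))) →
    ∃ λ t → Σ (Fin (suc (p pl t)) → Fin (suc m)) λ σ →
      (∀ j → Central r t (ρ (σ j))) × (∀ {i j} → i Fin.< j → σ i ≢ σ j)
  overfull-block ρ dρ with pigeonhole ℤ._≟_ (home ∘ ρ) (p pl) (supp pl) (outside pl) (allFin (suc m))
                                     budget<points
  ... | t , overfull = t , σ , central , distinct
    where
    js : List (Fin (suc m))
    js = fibre ℤ._≟_ (home ∘ ρ) t (allFin (suc m))
    σ : Fin (suc (p pl t)) → Fin (suc m)
    σ j = lookup js (Fin.inject≤ j overfull)
    central : ∀ j → Central r t (ρ (σ j))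
    central j = subst (λ t → Central r t (ρ (σ j)))
                      (All.lookup (all-filter (λ i → home (ρ i) ℤ.≟ t) (allFin (suc m))) (∈-lookup _))
                      (home-central (dρ (σ j)))
    distinct : ∀ {i j} → i Fin.< j → σ i ≢ σ j
    distinct {i} {j} i<j =
      lookup-AllPairs (Unique.filter⁺ (λ i → home (ρ i) ℤ.≟ t) (Unique.allFin⁺ (suc m)))
        (subst₂ _<_ (sym (Fin.toℕ-inject≤ i _)) (sym (Fin.toℕ-inject≤ j _)) i<j)

  universal-window-core : ∀ t K (ρ : Fin (suc K) → Fin (N G)) → (∀ j → Central r t (ρ j)) →
    Far G (2 * r') (suc K) ρ → Window t ⊨ variant universal K r' ψ → ∃ λ j → T (sat G ψ (λ _ → ρ j))
  universal-window-core t K ρ c far h =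
    let j , ψj = sat-bigOr⁻ (Window t) (suc K) (inst (mapSym old ψ)) ρ
                   (T-⇒⁻ (sat-alls⁻ (Window t) (suc K) _ h ρ in-window) guard)
    in j , subst T (trans (sat-inst (Window t) (mapSym old ψ) j ρ) (sat-window-core r'≤r (c j))) ψj
    where
    in-window : ∀ j → T (dom (Window t) (ρ j))
    in-window j = from T-∧ (Central.in-domain (c j) , central-in-block (c j))
    guard : T (sat (Window t) (bigAnd (suc K) (P M) ∧' pairwiseFar r' (suc K)) ρ)
    guard = from T-∧ (sat-bigAnd⁺ (Window t) (suc K) (P M) ρ (λ j → Central.in-middle (c j)) ,
                      sat-pairwiseFar⁺ (Window t) r' (suc K) ρ λ i<j walk →
                        far i<j (walk-weaken (λ dw → proj₁ (to T-∧ dw)) walk))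

  universal-case : (∀ t → Window t ⊨ variant universal (p pl t) r' ψ) → G ⊨ basic universal m r' ψ
  universal-case hyp = sat-alls⁺ G (suc m) _ λ ρ dρ → T-⇒⁺ λ pairwise →
    let t , σ , central , distinct = overfull-block ρ dρ
        far = sat-pairwiseFar⁻ G r' (suc m) ρ pairwise
        j , ψj = universal-window-core t (p pl t) (ρ ∘ σ) central
                   (λ i<j → far⇒apart G ρ dρ far (distinct i<j)) (hyp t)
    in sat-bigOr⁺ G (suc m) (inst ψ) ρ (σ j) (subst T (sym (sat-inst G ψ (σ j) ρ)) ψj)

lemma16 : ∀ {k : ℕ} (kind : Kind) (m r' : ℕ) (ψ : Fm (Fin k) 1) → Local r' ψ →
  (G : Str (Fin k)) (lay : Fin (N G) → ℤ) → IsLayering G lay →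
  (r ℓ : ℕ) → r' ≤ r → 4 * r < ℓ → (n : ℤ) → (pl : Plan m) →
  (∀ (t : ℤ) →
    extend (induced G (preimage lay (coverIv ℓ r n t)))
           (preimage lay (coverMid ℓ r n t (2 * r)))
           (preimage lay (coverMid ℓ r n t r))
      ⊨ variant kind (p pl t) r' ψ) →
  G ⊨ basic kind m r' ψ
lemma16 existential m r' ψ ψ-local G lay layering r ℓ r'≤r 4r<ℓ n pl =
  LayeredCover.existential-case r' ψ ψ-local G lay layering r ℓ r'≤r 4r<ℓ n pl
lemma16 universal   m r' ψ ψ-local G lay layering r ℓ r'≤r 4r<ℓ n pl =
  LayeredCover.universal-case r' ψ ψ-local G lay layering r ℓ r'≤r 4r<ℓ n pl
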